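{- Let $b\geq 2$ be an integer, let $n$ be a non-negative integer and let $N$ be a positive integer with $n<b^N$. Then, as an identity of polynomials in $x,y$, \[ \prod_{j=0}^{b-1}\binom{x+y+j-1}{j}^{\mu_j(n)} =\sum_{0\leq m\preceq n}\left[ \prod_{j=1}^{b-1}\binom{x+j-1}{j}^{\mu_j(m)} \prod_{j=1}^{b-1}\binom{y+j-1}{j}^{\mu_j(n-m)} \right]. \]
   Context: For a variable $z$ and a non-negative integer $j$, $\binom{z}{j}=z(z-1)\cdots(z-j+1)/j!$. For $0\le m\le b^N-1$ write $m=\sum_{i=0}^{N-1}d_i(m)b^i$ with base-$b$ digits $0\le d_i(m)\le b-1$. For a digit $j$, $\mu_j(m)=|\{i: d_i(m)=j\}|$ is the multiplicity of the digit $j$ in the base-$b$ expansion of $m$ (the factor with $j=0$ equals $1$ in any case). Digital dominance: $m\preceq n$ means $d_i(m)\le d_i(n)$ for all $i$. The sum runs over all integers $m\ge 0$ with $m\preceq n$. -}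

module Defs where

open import Data.Nat as ℕ using (ℕ; zero; suc; _≤_; _<_; NonZero)
open import Data.Nat.DivMod using (_/_; _%_)
open import Data.Integer using (+_)
open import Data.Rational as ℚ using (ℚ; 0ℚ; 1ℚ)
open import Data.List using (List; upTo; filter; foldr; map)
open import Data.List.Relation.Unary.All using (All; all?)
open import Relation.Nullary using (Dec)
import Data.Nat.Properties as ℕP

ℚ[_] : ℕ → ℚ
ℚ[ n ] = + n ℚ./ 1

binom : ℚ → ℕ → ℚ
binom z zero    = 1ℚ
binom z (suc j) = binom z j ℚ.* (z ℚ.- ℚ[ j ]) ℚ.* (+ 1 ℚ./ suc j)

infixr 8 _^ℚ_
_^ℚ_ : ℚ → ℕ → ℚ
q ^ℚ zero  = 1ℚ
q ^ℚ suc k = q ℚ.* (q ^ℚ k)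

-- finite product  ∏_{j = lo}^{lo + len - 1} f j
∏[_from_] : ℕ → ℕ → (ℕ → ℚ) → ℚ
∏[ zero  from lo ] f = 1ℚ
∏[ suc k from lo ] f = f lo ℚ.* ∏[ k from suc lo ] f

Σ-list : List ℕ → (ℕ → ℚ) → ℚ
Σ-list xs f = foldr (λ m acc → f m ℚ.+ acc) 0ℚ xs

digit : (b : ℕ) .{{_ : NonZero b}} → ℕ → ℕ → ℕ
digit b zero    m = m % b
digit b (suc i) m = digit b i (m / b)


μ : (b : ℕ) .{{_ : NonZero b}} → (N j m : ℕ) → ℕ
μ b N j m = Data.List.length (filter (λ i → digit b i m ℕ.≟ j) (upTo N))
  where import Data.List

_⪯[_,_]_ : ℕ → (b : ℕ) .{{_ : NonZero b}} → ℕ → ℕ → Set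
m ⪯[ b , N ] n = All (λ i → digit b i m ≤ digit b i n) (upTo N)

_⪯?[_,_]_ : (m : ℕ) (b : ℕ) .{{_ : NonZero b}} (N n : ℕ) → Dec (m ⪯[ b , N ] n)
m ⪯?[ b , N ] n = all? (λ i → digit b i m ℕ.≤? digit b i n) (upTo N)

dominated : (b : ℕ) .{{_ : NonZero b}} → ℕ → ℕ → List ℕ
dominated b N n = filter (λ m → m ⪯?[ b , N ] n) (upTo (b ℕ.^ N))

module Submission where

-- Write P_z(d) = binom (z + d - 1) d.  The left side is the digit product ∏ᵢ P_{x+y}(dᵢ(n)), and
-- each factor is a Vandermonde convolution P_{x+y}(d) = Σ_{a+c=d} P_x(a) P_y(c), true because both
-- sides satisfy (d + 1) F(d + 1) = (z + d) F(d) with F(0) = 1.  Expanding the product of these sums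
-- chooses digits aᵢ ≤ dᵢ(n) one position at a time; such choices are exactly the m = Σ aᵢ bⁱ with
-- m ⪯ n, and then n - m = Σ (dᵢ(n) - aᵢ) bⁱ since the subtraction never borrows.

open import Defs
open import Data.Nat as ℕ using (ℕ; zero; suc; _≤_; _<_; _^_; _∸_; NonZero; z≤n; s≤s; _≤?_; _≟_)
import Data.Nat.Properties as ℕP
open import Data.Nat.DivMod
open import Data.Nat.Divisibility using (n∣m*n)
open import Data.Nat.Solver using (module +-*-Solver)
import Data.Nat.Coprimality as Coprime
import Data.Integer as ℤ
import Data.Integer.Properties as ℤP
open import Data.Rational using (ℚ; mkℚ; _+_; _-_; _*_; 0ℚ; 1ℚ; 1/_)
open import Data.Rational.Properties
  using (↥p/↧p≡p; /-cong; *-inverseʳ; *-identityˡ; *-identityʳ; *-zeroˡ; *-zeroʳ; *-assoc; *-comm; *-distribˡ-+; *-distribʳ-+; +-identityˡ; +-identityʳ; +-assoc)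
open import Data.Rational.Solver using (module +-*-Solver)
open import Data.List using ([]; _∷_; applyUpTo; upTo; filter; length; map)
open import Data.List.Properties using (map-upTo)
open import Data.List.Relation.Unary.All using (All; []; _∷_)
open import Data.List.Relation.Unary.All.Properties using (map⁻; map⁺)
open import Data.Product as Product using (_×_; _,_; proj₁; proj₂)
open import Data.Empty using (⊥-elim)
open import Function using (_∘_)
open import Relation.Nullary using (Dec; yes; no)
open import Relation.Binary.PropositionalEquality
open ≡-Reasoning

private
  module ℚ-Solver = Data.Rational.Solver.+-*-Solver
  module ℕ-Solver = Data.Nat.Solver.+-*-Solver

ℚ[]≡mkℚ : ∀ n → ℚ[ n ] ≡ mkℚ (ℤ.+ n) 0 (Coprime.sym (Coprime.1-coprimeTo n))
ℚ[]≡mkℚ n = ↥p/↧p≡p (mkℚ (ℤ.+ n) 0 (Coprime.sym (Coprime.1-coprimeTo n)))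

ℚ[suc] : ∀ n → ℚ[ suc n ] ≡ ℚ[ n ] + 1ℚ
ℚ[suc] n = begin
  ℚ[ suc n ]                                           ≡⟨ /-cong (sym numerator) refl ⟩
  -- the unnormalised fraction that the sum mkℚ (+ n) 0 _ + 1ℚ computes to
  (ℤ.+ n ℤ.* ℤ.+ 1 ℤ.+ ℤ.+ 1 ℤ.* ℤ.+ 1) Data.Rational./ 1 ≡⟨ cong (_+ 1ℚ) (sym (ℚ[]≡mkℚ n)) ⟩
  ℚ[ n ] + 1ℚ                                          ∎
  where
  numerator : ℤ.+ n ℤ.* ℤ.+ 1 ℤ.+ ℤ.+ 1 ℤ.* ℤ.+ 1 ≡ ℤ.+ suc n
  numerator = trans (cong (ℤ._+ ℤ.+ 1) (ℤP.*-identityʳ (ℤ.+ n))) (cong ℤ.+_ (ℕP.+-comm n 1))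

ℚ[+] : ∀ m n → ℚ[ m ℕ.+ n ] ≡ ℚ[ m ] + ℚ[ n ]
ℚ[+] zero    n = sym (+-identityˡ ℚ[ n ])
ℚ[+] (suc m) n = begin
  ℚ[ suc (m ℕ.+ n) ]        ≡⟨ ℚ[suc] (m ℕ.+ n) ⟩
  ℚ[ m ℕ.+ n ] + 1ℚ         ≡⟨ cong (_+ 1ℚ) (ℚ[+] m n) ⟩
  ℚ[ m ] + ℚ[ n ] + 1ℚ      ≡⟨ solve 2 (λ p q → p :+ q :+ con 1ℚ := (p :+ con 1ℚ) :+ q) refl ℚ[ m ] ℚ[ n ] ⟩
  (ℚ[ m ] + 1ℚ) + ℚ[ n ]    ≡⟨ cong (_+ ℚ[ n ]) (sym (ℚ[suc] m)) ⟩
  ℚ[ suc m ] + ℚ[ n ]       ∎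
  where open ℚ-Solver

1/[1+_] : ℕ → ℚ
1/[1+ n ] = ℤ.+ 1 Data.Rational./ suc n

ℚ[suc]-inverseʳ : ∀ n → ℚ[ suc n ] * (1/[1+ n ]) ≡ 1ℚ
ℚ[suc]-inverseʳ n = begin
  ℚ[ suc n ] * (1/[1+ n ]) ≡⟨ cong₂ _*_ (ℚ[]≡mkℚ (suc n)) (↥p/↧p≡p (1/ p)) ⟩
  p * 1/ p                                   ≡⟨ *-inverseʳ p ⟩
  1ℚ                                         ∎
  where p = mkℚ (ℤ.+ suc n) 0 (Coprime.sym (Coprime.1-coprimeTo (suc n)))

ℚ[suc]-* : ∀ n p → ℚ[ suc n ] * p ≡ ℚ[ n ] * p + p
ℚ[suc]-* n p = begin
  ℚ[ suc n ] * p      ≡⟨ cong (_* p) (ℚ[suc] n) ⟩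
  (ℚ[ n ] + 1ℚ) * p   ≡⟨ *-distribʳ-+ p ℚ[ n ] 1ℚ ⟩
  ℚ[ n ] * p + 1ℚ * p ≡⟨ cong (ℚ[ n ] * p +_) (*-identityˡ p) ⟩
  ℚ[ n ] * p + p      ∎

ℚ[suc]-*-cancelˡ : ∀ n {p q} → ℚ[ suc n ] * p ≡ ℚ[ suc n ] * q → p ≡ q
ℚ[suc]-*-cancelˡ n {p} {q} eq = begin
  p                   ≡⟨ divide p ⟩
  i * (ℚ[ suc n ] * p) ≡⟨ cong (i *_) eq ⟩
  i * (ℚ[ suc n ] * q) ≡⟨ sym (divide q) ⟩
  q                   ∎
  where
  i = 1/[1+ n ]
  divide : ∀ r → r ≡ i * (ℚ[ suc n ] * r)
  divide r = begin
    r                    ≡⟨ sym (*-identityˡ r) ⟩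
    1ℚ * r               ≡⟨ cong (_* r) (sym (ℚ[suc]-inverseʳ n)) ⟩
    ℚ[ suc n ] * i * r   ≡⟨ solve 3 (λ r a i → a :* i :* r := i :* (a :* r)) refl r ℚ[ suc n ] i ⟩
    i * (ℚ[ suc n ] * r) ∎
    where open ℚ-Solver

binom-absorb : ∀ z d → binom z d * (z - ℚ[ d ]) ≡ z * binom (z - 1ℚ) d
binom-absorb z zero    = solve 1 (λ z → con 1ℚ :* (z :- con 0ℚ) := z :* con 1ℚ) refl z
  where open ℚ-Solver
binom-absorb z (suc d) = begin
  binom z d * (z - ℚ[ d ]) * i * (z - ℚ[ suc d ])       ≡⟨ cong (λ t → binom z d * (z - ℚ[ d ]) * i * (z - t)) (ℚ[suc] d) ⟩
  binom z d * (z - ℚ[ d ]) * i * (z - (ℚ[ d ] + 1ℚ))    ≡⟨ cong (λ t → t * i * (z - (ℚ[ d ] + 1ℚ))) (binom-absorb z d) ⟩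
  z * B * i * (z - (ℚ[ d ] + 1ℚ))                       ≡⟨ solve 4 (λ z B i q → z :* B :* i :* (z :- (q :+ con 1ℚ)) := z :* (B :* (z :- con 1ℚ :- q) :* i)) refl z B i ℚ[ d ] ⟩
  z * (B * (z - 1ℚ - ℚ[ d ]) * i)                       ∎
  where
  open ℚ-Solver
  i = 1/[1+ d ]
  B = binom (z - 1ℚ) d

multichoose : ℚ → ℕ → ℚ
multichoose x d = binom (x + ℚ[ d ] - ℚ[ 1 ]) d

MultichooseRecurrence : ℚ → (ℕ → ℚ) → Set
MultichooseRecurrence x F = ∀ d → ℚ[ suc d ] * F (suc d) ≡ (x + ℚ[ d ]) * F d

multichoose-recurrence : ∀ x → MultichooseRecurrence x (multichoose x)
multichoose-recurrence x d = begin
  ℚ[ suc d ] * (binom (x + ℚ[ suc d ] - 1ℚ) d * (x + ℚ[ suc d ] - 1ℚ - ℚ[ d ]) * i)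
    ≡⟨ cong (λ t → ℚ[ suc d ] * (binom t d * (t - ℚ[ d ]) * i)) upper-index ⟩
  ℚ[ suc d ] * (binom z d * (z - ℚ[ d ]) * i)
    ≡⟨ solve 3 (λ a b i → a :* (b :* i) := b :* (a :* i)) refl ℚ[ suc d ] (binom z d * (z - ℚ[ d ])) i ⟩
  binom z d * (z - ℚ[ d ]) * (ℚ[ suc d ] * i)
    ≡⟨ cong₂ _*_ (binom-absorb z d) (ℚ[suc]-inverseʳ d) ⟩
  z * multichoose x d * 1ℚ
    ≡⟨ *-identityʳ _ ⟩
  z * multichoose x d ∎
  where
  open ℚ-Solver
  i = 1/[1+ d ]
  z = x + ℚ[ d ]
  upper-index : x + ℚ[ suc d ] - 1ℚ ≡ z
  upper-index = trans (cong (λ t → x + t - 1ℚ) (ℚ[suc] d)) (solve 2 (λ x q → x :+ (q :+ con 1ℚ) :- con 1ℚ := x :+ q) refl x ℚ[ d ])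

recurrence-unique : ∀ {x F G} → MultichooseRecurrence x F → MultichooseRecurrence x G →
  F 0 ≡ G 0 → ∀ d → F d ≡ G d
recurrence-unique recF recG F0≡G0 zero    = F0≡G0
recurrence-unique {x} {F} {G} recF recG F0≡G0 (suc d) = ℚ[suc]-*-cancelˡ d (begin
  ℚ[ suc d ] * F (suc d) ≡⟨ recF d ⟩
  (x + ℚ[ d ]) * F d     ≡⟨ cong ((x + ℚ[ d ]) *_) (recurrence-unique {x} {F} {G} recF recG F0≡G0 d) ⟩
  (x + ℚ[ d ]) * G d     ≡⟨ sym (recG d) ⟩
  ℚ[ suc d ] * G (suc d) ∎)

antidiag : (ℕ → ℕ → ℚ) → ℕ → ℚ
antidiag h zero    = h 0 0
antidiag h (suc d) = h 0 (suc d) + antidiag (λ a c → h (suc a) c) d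

antidiag-cong : ∀ {h k} d → (∀ a c → h a c ≡ k a c) → antidiag h d ≡ antidiag k d
antidiag-cong zero    eq = eq 0 0
antidiag-cong (suc d) eq = cong₂ _+_ (eq 0 (suc d)) (antidiag-cong d (λ a c → eq (suc a) c))

antidiag-sucʳ : ∀ h d → antidiag h (suc d) ≡ antidiag (λ a c → h a (suc c)) d + h (suc d) 0
antidiag-sucʳ h zero    = refl
antidiag-sucʳ h (suc d) = begin
  h 0 (suc (suc d)) + antidiag (λ a c → h (suc a) c) (suc d)
    ≡⟨ cong (h 0 (suc (suc d)) +_) (antidiag-sucʳ (λ a c → h (suc a) c) d) ⟩
  h 0 (suc (suc d)) + (antidiag (λ a c → h (suc a) (suc c)) d + h (suc (suc d)) 0)
    ≡⟨ sym (+-assoc (h 0 (suc (suc d))) (antidiag (λ a c → h (suc a) (suc c)) d) (h (suc (suc d)) 0)) ⟩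
  h 0 (suc (suc d)) + antidiag (λ a c → h (suc a) (suc c)) d + h (suc (suc d)) 0 ∎

antidiag-+ : ∀ h k d → antidiag (λ a c → h a c + k a c) d ≡ antidiag h d + antidiag k d
antidiag-+ h k zero    = refl
antidiag-+ h k (suc d) = begin
  h 0 (suc d) + k 0 (suc d) + antidiag (λ a c → h (suc a) c + k (suc a) c) d
    ≡⟨ cong (h 0 (suc d) + k 0 (suc d) +_) (antidiag-+ (λ a c → h (suc a) c) (λ a c → k (suc a) c) d) ⟩
  h 0 (suc d) + k 0 (suc d) + (H + K)
    ≡⟨ solve 4 (λ p q r s → p :+ q :+ (r :+ s) := p :+ r :+ (q :+ s)) refl (h 0 (suc d)) (k 0 (suc d)) H K ⟩
  h 0 (suc d) + H + (k 0 (suc d) + K) ∎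
  where
  open ℚ-Solver
  H = antidiag (λ a c → h (suc a) c) d
  K = antidiag (λ a c → k (suc a) c) d

antidiag-*ˡ : ∀ r h d → antidiag (λ a c → r * h a c) d ≡ r * antidiag h d
antidiag-*ˡ r h zero    = refl
antidiag-*ˡ r h (suc d) = begin
  r * h 0 (suc d) + antidiag (λ a c → r * h (suc a) c) d ≡⟨ cong (r * h 0 (suc d) +_) (antidiag-*ˡ r (λ a c → h (suc a) c) d) ⟩
  r * h 0 (suc d) + r * antidiag (λ a c → h (suc a) c) d ≡⟨ sym (*-distribˡ-+ r _ _) ⟩
  r * antidiag h (suc d)                                 ∎

antidiag-weight : ∀ h d → antidiag (λ a c → ℚ[ a ℕ.+ c ] * h a c) d ≡ ℚ[ d ] * antidiag h d
antidiag-weight h zero    = refl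
antidiag-weight h (suc d) = begin
  ℚ[ suc d ] * h 0 (suc d) + antidiag (λ a c → ℚ[ suc (a ℕ.+ c) ] * h⁺ a c) d
    ≡⟨ cong (ℚ[ suc d ] * h 0 (suc d) +_) (antidiag-cong d (λ a c → ℚ[suc]-* (a ℕ.+ c) (h⁺ a c))) ⟩
  ℚ[ suc d ] * h 0 (suc d) + antidiag (λ a c → ℚ[ a ℕ.+ c ] * h⁺ a c + h⁺ a c) d
    ≡⟨ cong (ℚ[ suc d ] * h 0 (suc d) +_) (antidiag-+ (λ a c → ℚ[ a ℕ.+ c ] * h⁺ a c) h⁺ d) ⟩
  ℚ[ suc d ] * h 0 (suc d) + (antidiag (λ a c → ℚ[ a ℕ.+ c ] * h⁺ a c) d + H)
    ≡⟨ cong (λ t → ℚ[ suc d ] * h 0 (suc d) + (t + H)) (antidiag-weight h⁺ d) ⟩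
  ℚ[ suc d ] * h 0 (suc d) + (ℚ[ d ] * H + H)
    ≡⟨ cong (ℚ[ suc d ] * h 0 (suc d) +_) (sym (ℚ[suc]-* d H)) ⟩
  ℚ[ suc d ] * h 0 (suc d) + ℚ[ suc d ] * H
    ≡⟨ sym (*-distribˡ-+ ℚ[ suc d ] (h 0 (suc d)) H) ⟩
  ℚ[ suc d ] * antidiag h (suc d) ∎
  where
  h⁺ = λ a c → h (suc a) c
  H  = antidiag h⁺ d

infixl 7 _⋆_
_⋆_ : (ℕ → ℚ) → (ℕ → ℚ) → ℕ → ℚ
(F ⋆ G) = antidiag (λ a c → F a * G c)

⋆-weightˡ : ∀ {x F} → MultichooseRecurrence x F → ∀ (G : ℕ → ℚ) d →
  antidiag (λ a c → ℚ[ a ] * (F a * G c)) (suc d) ≡ antidiag (λ a c → (x + ℚ[ a ]) * (F a * G c)) d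
⋆-weightˡ {x} {F} recF G d = begin
  ℚ[ 0 ] * (F 0 * G (suc d)) + S                               ≡⟨ cong (_+ S) (*-zeroˡ (F 0 * G (suc d))) ⟩
  0ℚ + S                                                       ≡⟨ +-identityˡ S ⟩
  S                                                            ≡⟨ antidiag-cong d shift ⟩
  antidiag (λ a c → (x + ℚ[ a ]) * (F a * G c)) d              ∎
  where
  S = antidiag (λ a c → ℚ[ suc a ] * (F (suc a) * G c)) d
  shift : ∀ a c → ℚ[ suc a ] * (F (suc a) * G c) ≡ (x + ℚ[ a ]) * (F a * G c)
  shift a c = begin
    ℚ[ suc a ] * (F (suc a) * G c) ≡⟨ sym (*-assoc ℚ[ suc a ] (F (suc a)) (G c)) ⟩
    ℚ[ suc a ] * F (suc a) * G c   ≡⟨ cong (_* G c) (recF a) ⟩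
    (x + ℚ[ a ]) * F a * G c       ≡⟨ *-assoc (x + ℚ[ a ]) (F a) (G c) ⟩
    (x + ℚ[ a ]) * (F a * G c)     ∎

⋆-weightʳ : ∀ {y G} → MultichooseRecurrence y G → ∀ (F : ℕ → ℚ) d →
  antidiag (λ a c → ℚ[ c ] * (F a * G c)) (suc d) ≡ antidiag (λ a c → (y + ℚ[ c ]) * (F a * G c)) d
⋆-weightʳ {y} {G} recG F d = begin
  antidiag (λ a c → ℚ[ c ] * (F a * G c)) (suc d)   ≡⟨ antidiag-sucʳ (λ a c → ℚ[ c ] * (F a * G c)) d ⟩
  S + ℚ[ 0 ] * (F (suc d) * G 0)                   ≡⟨ cong (S +_) (*-zeroˡ (F (suc d) * G 0)) ⟩
  S + 0ℚ                                           ≡⟨ +-identityʳ S ⟩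
  S                                                ≡⟨ antidiag-cong d shift ⟩
  antidiag (λ a c → (y + ℚ[ c ]) * (F a * G c)) d  ∎
  where
  open ℚ-Solver
  S = antidiag (λ a c → ℚ[ suc c ] * (F a * G (suc c))) d
  shift : ∀ a c → ℚ[ suc c ] * (F a * G (suc c)) ≡ (y + ℚ[ c ]) * (F a * G c)
  shift a c = begin
    ℚ[ suc c ] * (F a * G (suc c)) ≡⟨ solve 3 (λ q u v → q :* (u :* v) := u :* (q :* v)) refl ℚ[ suc c ] (F a) (G (suc c)) ⟩
    F a * (ℚ[ suc c ] * G (suc c)) ≡⟨ cong (F a *_) (recG c) ⟩
    F a * ((y + ℚ[ c ]) * G c)     ≡⟨ solve 3 (λ u p v → u :* (p :* v) := p :* (u :* v)) refl (F a) (y + ℚ[ c ]) (G c) ⟩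
    (y + ℚ[ c ]) * (F a * G c)     ∎

⋆-recurrence : ∀ {x y F G} → MultichooseRecurrence x F → MultichooseRecurrence y G →
  MultichooseRecurrence (x + y) (F ⋆ G)
⋆-recurrence {x} {y} {F} {G} recF recG d = begin
  ℚ[ suc d ] * (F ⋆ G) (suc d)
    ≡⟨ sym (antidiag-weight H (suc d)) ⟩
  antidiag (λ a c → ℚ[ a ℕ.+ c ] * H a c) (suc d)
    ≡⟨ antidiag-cong (suc d) (λ a c → trans (cong (_* H a c) (ℚ[+] a c)) (*-distribʳ-+ (H a c) ℚ[ a ] ℚ[ c ])) ⟩
  antidiag (λ a c → ℚ[ a ] * H a c + ℚ[ c ] * H a c) (suc d)
    ≡⟨ antidiag-+ (λ a c → ℚ[ a ] * H a c) (λ a c → ℚ[ c ] * H a c) (suc d) ⟩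
  antidiag (λ a c → ℚ[ a ] * H a c) (suc d) + antidiag (λ a c → ℚ[ c ] * H a c) (suc d)
    ≡⟨ cong₂ _+_ (⋆-weightˡ {x} {F} recF G d) (⋆-weightʳ {y} {G} recG F d) ⟩
  antidiag (λ a c → (x + ℚ[ a ]) * H a c) d + antidiag (λ a c → (y + ℚ[ c ]) * H a c) d
    ≡⟨ sym (antidiag-+ (λ a c → (x + ℚ[ a ]) * H a c) (λ a c → (y + ℚ[ c ]) * H a c) d) ⟩
  antidiag (λ a c → (x + ℚ[ a ]) * H a c + (y + ℚ[ c ]) * H a c) d
    ≡⟨ antidiag-cong d regroup ⟩
  antidiag (λ a c → (x + y) * H a c + ℚ[ a ℕ.+ c ] * H a c) d
    ≡⟨ antidiag-+ (λ a c → (x + y) * H a c) (λ a c → ℚ[ a ℕ.+ c ] * H a c) d ⟩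
  antidiag (λ a c → (x + y) * H a c) d + antidiag (λ a c → ℚ[ a ℕ.+ c ] * H a c) d
    ≡⟨ cong₂ _+_ (antidiag-*ˡ (x + y) H d) (antidiag-weight H d) ⟩
  (x + y) * (F ⋆ G) d + ℚ[ d ] * (F ⋆ G) d
    ≡⟨ sym (*-distribʳ-+ ((F ⋆ G) d) (x + y) ℚ[ d ]) ⟩
  (x + y + ℚ[ d ]) * (F ⋆ G) d ∎
  where
  open ℚ-Solver
  H = λ a c → F a * G c
  regroup : ∀ a c → (x + ℚ[ a ]) * H a c + (y + ℚ[ c ]) * H a c ≡ (x + y) * H a c + ℚ[ a ℕ.+ c ] * H a c
  regroup a c = begin
    (x + ℚ[ a ]) * H a c + (y + ℚ[ c ]) * H a c      ≡⟨ solve 5 (λ x y p q h → (x :+ p) :* h :+ (y :+ q) :* h := (x :+ y) :* h :+ (p :+ q) :* h) refl x y ℚ[ a ] ℚ[ c ] (H a c) ⟩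
    (x + y) * H a c + (ℚ[ a ] + ℚ[ c ]) * H a c      ≡⟨ cong (λ t → (x + y) * H a c + t * H a c) (sym (ℚ[+] a c)) ⟩
    (x + y) * H a c + ℚ[ a ℕ.+ c ] * H a c           ∎

multichoose-vandermonde : ∀ x y d → (multichoose x ⋆ multichoose y) d ≡ multichoose (x + y) d
multichoose-vandermonde x y = recurrence-unique {x + y} {multichoose x ⋆ multichoose y}
  (⋆-recurrence {x} {y} {multichoose x} {multichoose y} (multichoose-recurrence x) (multichoose-recurrence y))
  (multichoose-recurrence (x + y)) refl

iverson : ∀ {P : Set} → Dec P → ℚ → ℚ
iverson (yes _) v = v
iverson (no _)  v = 0ℚ

iverson-× : ∀ {P Q R : Set} (R? : Dec R) (P? : Dec P) (Q? : Dec Q) {u v w : ℚ} →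
  (R → P × Q) → (P → Q → R) → (R → u ≡ v * w) → iverson R? u ≡ iverson P? v * iverson Q? w
iverson-× (yes r) (yes _) (yes _) _     _    value = value r
iverson-× (yes r) (no ¬p) _       split _    _     = ⊥-elim (¬p (proj₁ (split r)))
iverson-× (yes r) (yes _) (no ¬q) split _    _     = ⊥-elim (¬q (proj₂ (split r)))
iverson-× (no ¬r) (yes p) (yes q) _     join _     = ⊥-elim (¬r (join p q))
iverson-× (no _)  (no _)  Q?      _     _    _     = sym (*-zeroˡ (iverson Q? _))
iverson-× (no _)  (yes _) (no _) {v = v} _ _ _ = sym (*-zeroʳ v)

Σ< : ℕ → (ℕ → ℚ) → ℚ
Σ< zero    g = 0ℚ
Σ< (suc n) g = g 0 + Σ< n (λ k → g (suc k))

Σ<-cong : ∀ n {g h} → (∀ k → k < n → g k ≡ h k) → Σ< n g ≡ Σ< n h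
Σ<-cong zero    eq = refl
Σ<-cong (suc n) eq = cong₂ _+_ (eq 0 (s≤s z≤n)) (Σ<-cong n (λ k k<n → eq (suc k) (s≤s k<n)))

Σ<-zero : ∀ n {g} → (∀ k → g k ≡ 0ℚ) → Σ< n g ≡ 0ℚ
Σ<-zero zero    vanish = refl
Σ<-zero (suc n) vanish = cong₂ _+_ (vanish 0) (Σ<-zero n (λ k → vanish (suc k)))

Σ<-truncate : ∀ {m n g} → m ≤ n → (∀ k → m ≤ k → g k ≡ 0ℚ) → Σ< n g ≡ Σ< m g
Σ<-truncate {zero}  {n}     z≤n       vanish = Σ<-zero n (λ k → vanish k z≤n)
Σ<-truncate {suc m} {suc n} {g} (s≤s m≤n) vanish = cong (g 0 +_) (Σ<-truncate m≤n (λ k m≤k → vanish (suc k) (s≤s m≤k)))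

Σ<-+ : ∀ m n g → Σ< (m ℕ.+ n) g ≡ Σ< m g + Σ< n (λ k → g (m ℕ.+ k))
Σ<-+ zero    n g = sym (+-identityˡ (Σ< n g))
Σ<-+ (suc m) n g = begin
  g 0 + Σ< (m ℕ.+ n) (λ k → g (suc k))
    ≡⟨ cong (g 0 +_) (Σ<-+ m n (λ k → g (suc k))) ⟩
  g 0 + (Σ< m (λ k → g (suc k)) + Σ< n (λ k → g (suc m ℕ.+ k)))
    ≡⟨ sym (+-assoc (g 0) (Σ< m (λ k → g (suc k))) (Σ< n (λ k → g (suc m ℕ.+ k)))) ⟩
  g 0 + Σ< m (λ k → g (suc k)) + Σ< n (λ k → g (suc m ℕ.+ k)) ∎

Σ<-*ˡ : ∀ n c g → Σ< n (λ k → c * g k) ≡ c * Σ< n g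
Σ<-*ˡ zero    c g = sym (*-zeroʳ c)
Σ<-*ˡ (suc n) c g = trans (cong (c * g 0 +_) (Σ<-*ˡ n c (λ k → g (suc k))))
                          (sym (*-distribˡ-+ c (g 0) (Σ< n (λ k → g (suc k)))))

Σ<-*ʳ : ∀ n c g → Σ< n (λ k → g k * c) ≡ Σ< n g * c
Σ<-*ʳ n c g = begin
  Σ< n (λ k → g k * c) ≡⟨ Σ<-cong n (λ k _ → *-comm (g k) c) ⟩
  Σ< n (λ k → c * g k) ≡⟨ Σ<-*ˡ n c g ⟩
  c * Σ< n g           ≡⟨ *-comm c (Σ< n g) ⟩
  Σ< n g * c           ∎

Σ<-divMod : ∀ n b g → Σ< (n ℕ.* b) g ≡ Σ< n (λ q → Σ< b (λ r → g (r ℕ.+ q ℕ.* b)))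
Σ<-divMod zero    b g = refl
Σ<-divMod (suc n) b g = begin
  Σ< (b ℕ.+ n ℕ.* b) g
    ≡⟨ Σ<-+ b (n ℕ.* b) g ⟩
  Σ< b g + Σ< (n ℕ.* b) (λ k → g (b ℕ.+ k))
    ≡⟨ cong₂ _+_ (Σ<-cong b (λ r _ → cong g (sym (ℕP.+-identityʳ r)))) (Σ<-divMod n b (λ k → g (b ℕ.+ k))) ⟩
  Σ< b (λ r → g (r ℕ.+ 0)) + Σ< n (λ q → Σ< b (λ r → g (b ℕ.+ (r ℕ.+ q ℕ.* b))))
    ≡⟨ cong (Σ< b (λ r → g (r ℕ.+ 0)) +_) (Σ<-cong n (λ q _ → Σ<-cong b (λ r _ → cong g (regroup r q)))) ⟩
  Σ< b (λ r → g (r ℕ.+ 0)) + Σ< n (λ q → Σ< b (λ r → g (r ℕ.+ suc q ℕ.* b))) ∎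
  where
  open ℕ-Solver
  regroup : ∀ r q → b ℕ.+ (r ℕ.+ q ℕ.* b) ≡ r ℕ.+ suc q ℕ.* b
  regroup r q = solve 3 (λ r q b → b :+ (r :+ q :* b) := r :+ (con 1 :+ q) :* b) refl r q b

antidiag≡Σ< : ∀ h d → antidiag h d ≡ Σ< (suc d) (λ a → h a (d ∸ a))
antidiag≡Σ< h zero    = sym (+-identityʳ (h 0 0))
antidiag≡Σ< h (suc d) = cong (h 0 (suc d) +_) (antidiag≡Σ< (λ a c → h (suc a) c) d)

antidiag≡Σ<-iverson : ∀ h {d n} → d < n → antidiag h d ≡ Σ< n (λ a → iverson (a ≤? d) (h a (d ∸ a)))
antidiag≡Σ<-iverson h {d} {n} d<n = begin
  antidiag h d                         ≡⟨ antidiag≡Σ< h d ⟩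
  Σ< (suc d) (λ a → h a (d ∸ a))       ≡⟨ Σ<-cong (suc d) (λ a a≤d → sym (kept a (ℕP.≤-pred a≤d))) ⟩
  Σ< (suc d) g                         ≡⟨ sym (Σ<-truncate d<n (λ a d<a → dropped a d<a)) ⟩
  Σ< n g                               ∎
  where
  g = λ a → iverson (a ≤? d) (h a (d ∸ a))
  kept : ∀ a → a ≤ d → g a ≡ h a (d ∸ a)
  kept a a≤d with a ≤? d
  ... | yes _   = refl
  ... | no  a≰d = ⊥-elim (a≰d a≤d)
  dropped : ∀ a → d < a → g a ≡ 0ℚ
  dropped a d<a with a ≤? d
  ... | yes a≤d = ⊥-elim (ℕP.<⇒≱ d<a a≤d)
  ... | no  _   = refl

Σ-list-cong : ∀ xs {g h} → (∀ m → g m ≡ h m) → Σ-list xs g ≡ Σ-list xs h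
Σ-list-cong []       eq = refl
Σ-list-cong (x ∷ xs) eq = cong₂ _+_ (eq x) (Σ-list-cong xs eq)

Σ-list-filter : ∀ {P : ℕ → Set} (P? : ∀ m → Dec (P m)) xs g →
  Σ-list (filter P? xs) g ≡ Σ-list xs (λ m → iverson (P? m) (g m))
Σ-list-filter P? []       g = refl
Σ-list-filter P? (x ∷ xs) g with P? x
... | yes _ = cong (g x +_) (Σ-list-filter P? xs g)
... | no  _ = trans (Σ-list-filter P? xs g) (sym (+-identityˡ _))

Σ-list-applyUpTo : ∀ f n g → Σ-list (applyUpTo f n) g ≡ Σ< n (λ k → g (f k))
Σ-list-applyUpTo f zero    g = refl
Σ-list-applyUpTo f (suc n) g = cong (g (f 0) +_) (Σ-list-applyUpTo (λ k → f (suc k)) n g)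

∏-cong : ∀ k lo {f g} → (∀ j → f j ≡ g j) → ∏[ k from lo ] f ≡ ∏[ k from lo ] g
∏-cong zero    lo eq = refl
∏-cong (suc k) lo eq = cong₂ _*_ (eq lo) (∏-cong k (suc lo) eq)

∏-* : ∀ k lo f g → ∏[ k from lo ] (λ j → f j * g j) ≡ ∏[ k from lo ] f * ∏[ k from lo ] g
∏-* zero    lo f g = refl
∏-* (suc k) lo f g = begin
  f lo * g lo * ∏[ k from suc lo ] (λ j → f j * g j)  ≡⟨ cong (f lo * g lo *_) (∏-* k (suc lo) f g) ⟩
  f lo * g lo * (∏[ k from suc lo ] f * ∏[ k from suc lo ] g)
    ≡⟨ solve 4 (λ a b c d → a :* b :* (c :* d) := a :* c :* (b :* d)) refl (f lo) (g lo) (∏[ k from suc lo ] f) (∏[ k from suc lo ] g) ⟩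
  f lo * ∏[ k from suc lo ] f * (g lo * ∏[ k from suc lo ] g) ∎
  where open ℚ-Solver

∏-1ℚ : ∀ k lo → ∏[ k from lo ] (λ _ → 1ℚ) ≡ 1ℚ
∏-1ℚ zero    lo = refl
∏-1ℚ (suc k) lo = trans (*-identityˡ _) (∏-1ℚ k (suc lo))

^ℚ-+ : ∀ q m n → q ^ℚ (m ℕ.+ n) ≡ q ^ℚ m * q ^ℚ n
^ℚ-+ q zero    n = sym (*-identityˡ (q ^ℚ n))
^ℚ-+ q (suc m) n = trans (cong (q *_) (^ℚ-+ q m n)) (sym (*-assoc q (q ^ℚ m) (q ^ℚ n)))

1^ℚ : ∀ n → 1ℚ ^ℚ n ≡ 1ℚ
1^ℚ zero    = refl
1^ℚ (suc n) = trans (*-identityˡ _) (1^ℚ n)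

indicator : ∀ {P : Set} → Dec P → ℕ
indicator (yes _) = 1
indicator (no _)  = 0

∏-^-indicator-below : ∀ (F : ℕ → ℚ) {c} k lo → c < lo → ∏[ k from lo ] (λ j → F j ^ℚ indicator (c ≟ j)) ≡ 1ℚ
∏-^-indicator-below F {c} zero    lo c<lo = refl
∏-^-indicator-below F {c} (suc k) lo c<lo with c ≟ lo
... | yes refl = ⊥-elim (ℕP.<-irrefl refl c<lo)
... | no  _    = trans (*-identityˡ _) (∏-^-indicator-below F k (suc lo) (ℕP.m<n⇒m<1+n c<lo))

∏-^-indicator : ∀ (F : ℕ → ℚ) {c} k lo → lo ≤ c → c < lo ℕ.+ k → ∏[ k from lo ] (λ j → F j ^ℚ indicator (c ≟ j)) ≡ F c
∏-^-indicator F {c} zero    lo lo≤c c<lo+0 = ⊥-elim (ℕP.<⇒≱ c<lo+0 (subst (_≤ c) (sym (ℕP.+-identityʳ lo)) lo≤c))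
∏-^-indicator F {c} (suc k) lo lo≤c c<lo+k+1 with c ≟ lo
... | yes refl = trans (cong₂ _*_ (*-identityʳ (F c)) (∏-^-indicator-below F k (suc lo) (ℕP.n<1+n c))) (*-identityʳ (F c))
... | no  c≢lo = trans (*-identityˡ _)
      (∏-^-indicator F k (suc lo) (ℕP.≤∧≢⇒< lo≤c (c≢lo ∘ sym)) (subst (c <_) (ℕP.+-suc lo k) c<lo+k+1))

length-filter-∷ : ∀ {A : Set} {P : A → Set} (P? : ∀ x → Dec (P x)) x xs →
  length (filter P? (x ∷ xs)) ≡ indicator (P? x) ℕ.+ length (filter P? xs)
length-filter-∷ P? x xs with P? x
... | yes _ = refl
... | no  _ = refl

length-filter-map : ∀ {A B : Set} {P : B → Set} (P? : ∀ y → Dec (P y)) (f : A → B) xs →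
  length (filter P? (map f xs)) ≡ length (filter (λ x → P? (f x)) xs)
length-filter-map P? f []       = refl
length-filter-map P? f (x ∷ xs) with P? (f x)
... | yes _ = cong suc (length-filter-map P? f xs)
... | no  _ = length-filter-map P? f xs

∸-digitwise : ∀ b {r q n₀ n₁} → r ≤ n₀ → q ≤ n₁ → (n₀ ℕ.+ n₁ ℕ.* b) ∸ (r ℕ.+ q ℕ.* b) ≡ (n₀ ∸ r) ℕ.+ (n₁ ∸ q) ℕ.* b
∸-digitwise b {r} {q} {n₀} {n₁} r≤n₀ q≤n₁ = begin
  (n₀ ℕ.+ n₁ ℕ.* b) ∸ (r ℕ.+ q ℕ.* b)          ≡⟨ cong (_∸ (r ℕ.+ q ℕ.* b)) (sym recombine) ⟩
  (u ℕ.+ v ℕ.* b) ℕ.+ (r ℕ.+ q ℕ.* b) ∸ (r ℕ.+ q ℕ.* b) ≡⟨ ℕP.m+n∸n≡m (u ℕ.+ v ℕ.* b) (r ℕ.+ q ℕ.* b) ⟩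
  u ℕ.+ v ℕ.* b                                ∎
  where
  open ℕ-Solver
  u = n₀ ∸ r
  v = n₁ ∸ q
  recombine : u ℕ.+ v ℕ.* b ℕ.+ (r ℕ.+ q ℕ.* b) ≡ n₀ ℕ.+ n₁ ℕ.* b
  recombine = begin
    u ℕ.+ v ℕ.* b ℕ.+ (r ℕ.+ q ℕ.* b)   ≡⟨ solve 5 (λ u v r q b → u :+ v :* b :+ (r :+ q :* b) := (u :+ r) :+ (v :+ q) :* b) refl u v r q b ⟩
    (u ℕ.+ r) ℕ.+ (v ℕ.+ q) ℕ.* b       ≡⟨ cong₂ (λ s t → s ℕ.+ t ℕ.* b) (ℕP.m∸n+n≡m r≤n₀) (ℕP.m∸n+n≡m q≤n₁) ⟩
    n₀ ℕ.+ n₁ ℕ.* b                     ∎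

module Digits (b : ℕ) .{{_ : NonZero b}} where

  digitProduct : ℕ → (ℕ → ℚ) → ℕ → ℚ
  digitProduct zero    F m = 1ℚ
  digitProduct (suc N) F m = F (m % b) * digitProduct N F (m / b)

  digitProduct-cong : ∀ N {F G} → (∀ d → F d ≡ G d) → ∀ m → digitProduct N F m ≡ digitProduct N G m
  digitProduct-cong zero    eq m = refl
  digitProduct-cong (suc N) eq m = cong₂ _*_ (eq (m % b)) (digitProduct-cong N eq (m / b))

  μ-suc : ∀ N j m → μ b (suc N) j m ≡ indicator (m % b ≟ j) ℕ.+ μ b N j (m / b)
  μ-suc N j m = begin
    length (filter P? (0 ∷ applyUpTo suc N))                 ≡⟨ length-filter-∷ P? 0 (applyUpTo suc N) ⟩
    indicator (P? 0) ℕ.+ length (filter P? (applyUpTo suc N)) ≡⟨ cong (λ is → indicator (P? 0) ℕ.+ length (filter P? is)) (sym (map-upTo suc N)) ⟩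
    indicator (P? 0) ℕ.+ length (filter P? (map suc (upTo N))) ≡⟨ cong (indicator (P? 0) ℕ.+_) (length-filter-map P? suc (upTo N)) ⟩
    indicator (P? 0) ℕ.+ μ b N j (m / b)                      ∎
    where
    P? = λ i → digit b i m ≟ j

  ∏-^μ : ∀ N F m → ∏[ b from 0 ] (λ j → F j ^ℚ μ b N j m) ≡ digitProduct N F m
  ∏-^μ zero    F m = ∏-1ℚ b 0
  ∏-^μ (suc N) F m = begin
    ∏[ b from 0 ] (λ j → F j ^ℚ μ b (suc N) j m)
      ≡⟨ ∏-cong b 0 (λ j → trans (cong (F j ^ℚ_) (μ-suc N j m)) (^ℚ-+ (F j) (indicator (m % b ≟ j)) (μ b N j (m / b)))) ⟩
    ∏[ b from 0 ] (λ j → F j ^ℚ indicator (m % b ≟ j) * F j ^ℚ μ b N j (m / b))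
      ≡⟨ ∏-* b 0 (λ j → F j ^ℚ indicator (m % b ≟ j)) (λ j → F j ^ℚ μ b N j (m / b)) ⟩
    ∏[ b from 0 ] (λ j → F j ^ℚ indicator (m % b ≟ j)) * ∏[ b from 0 ] (λ j → F j ^ℚ μ b N j (m / b))
      ≡⟨ cong₂ _*_ (∏-^-indicator F b 0 z≤n (m%n<n m b)) (∏-^μ N F (m / b)) ⟩
    F (m % b) * digitProduct N F (m / b) ∎

  [r+qb]%b≡r : ∀ {r} q → r < b → (r ℕ.+ q ℕ.* b) % b ≡ r
  [r+qb]%b≡r {r} q r<b = trans ([m+kn]%n≡m%n r q b) (m<n⇒m%n≡m r<b)

  [r+qb]/b≡q : ∀ {r} q → r < b → (r ℕ.+ q ℕ.* b) / b ≡ q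
  [r+qb]/b≡q {r} q r<b = trans (+-distrib-/-∣ʳ r (n∣m*n q)) (cong₂ ℕ._+_ (m<n⇒m/n≡0 r<b) (m*n/n≡m q b))

  digitProduct-digits : ∀ N F {r} q → r < b → digitProduct (suc N) F (r ℕ.+ q ℕ.* b) ≡ F r * digitProduct N F q
  digitProduct-digits N F q r<b = cong₂ (λ d m → F d * digitProduct N F m) ([r+qb]%b≡r q r<b) ([r+qb]/b≡q q r<b)

  m<b^[1+N]⇒m/b<b^N : ∀ N {m} → m < b ^ suc N → m / b < b ^ N
  m<b^[1+N]⇒m/b<b^N N {m} m<bᴺ⁺¹ = m<n*o⇒m/o<n (subst (m <_) (ℕP.*-comm b (b ^ N)) m<bᴺ⁺¹)

  ⪯-suc⁻ : ∀ N {m n} → m ⪯[ b , suc N ] n → m % b ≤ n % b × (m / b) ⪯[ b , N ] (n / b)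
  ⪯-suc⁻ N {m} {n} (low ∷ high) =
    low , map⁻ (subst (All (λ i → digit b i m ≤ digit b i n)) (sym (map-upTo suc N)) high)

  ⪯-suc⁺ : ∀ N {m n} → m % b ≤ n % b → (m / b) ⪯[ b , N ] (n / b) → m ⪯[ b , suc N ] n
  ⪯-suc⁺ N {m} {n} low high =
    low ∷ subst (All (λ i → digit b i m ≤ digit b i n)) (map-upTo suc N) (map⁺ high)

  ⪯⇒≤ : ∀ N {m n} → m ⪯[ b , N ] n → m < b ^ N → m ≤ n
  ⪯⇒≤ zero    {zero}  _   _           = z≤n
  ⪯⇒≤ zero    {suc m} _   (s≤s ())
  ⪯⇒≤ (suc N) {m} {n} m⪯n m<bᴺ⁺¹ = subst₂ _≤_ (sym (m≡m%n+[m/n]*n m b)) (sym (m≡m%n+[m/n]*n n b))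
    (ℕP.+-mono-≤ low (ℕP.*-monoˡ-≤ b (⪯⇒≤ N high (m<b^[1+N]⇒m/b<b^N N m<bᴺ⁺¹))))
    where
    low  = proj₁ (⪯-suc⁻ N m⪯n)
    high = proj₂ (⪯-suc⁻ N m⪯n)

  dominatedTerm : ℕ → (F G : ℕ → ℚ) → ℕ → ℕ → ℚ
  dominatedTerm N F G n m = iverson (m ⪯?[ b , N ] n) (digitProduct N F m * digitProduct N G (n ∸ m))

  dominatedTerm-digits : ∀ N F G n {q r} → q < b ^ N → r < b →
    dominatedTerm (suc N) F G n (r ℕ.+ q ℕ.* b)
      ≡ iverson (r ≤? n % b) (F r * G (n % b ∸ r)) * dominatedTerm N F G (n / b) q
  dominatedTerm-digits N F G n {q} {r} q<bᴺ r<b =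
    iverson-× (m ⪯?[ b , suc N ] n) (r ≤? n % b) (q ⪯?[ b , N ] (n / b)) split join value
    where
    m = r ℕ.+ q ℕ.* b
    split : m ⪯[ b , suc N ] n → r ≤ n % b × q ⪯[ b , N ] (n / b)
    split = Product.map (subst (_≤ n % b) ([r+qb]%b≡r q r<b))
                        (subst (λ k → k ⪯[ b , N ] (n / b)) ([r+qb]/b≡q q r<b))
          ∘ ⪯-suc⁻ N
    join : r ≤ n % b → q ⪯[ b , N ] (n / b) → m ⪯[ b , suc N ] n
    join low high = ⪯-suc⁺ N (subst (_≤ n % b) (sym ([r+qb]%b≡r q r<b)) low)
                             (subst (λ k → k ⪯[ b , N ] (n / b)) (sym ([r+qb]/b≡q q r<b)) high)
    value : m ⪯[ b , suc N ] n →
      digitProduct (suc N) F m * digitProduct (suc N) G (n ∸ m)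
        ≡ F r * G (n % b ∸ r) * (digitProduct N F q * digitProduct N G (n / b ∸ q))
    value m⪯n = begin
      digitProduct (suc N) F m * digitProduct (suc N) G (n ∸ m)
        ≡⟨ cong₂ _*_ (digitProduct-digits N F q r<b) (cong (digitProduct (suc N) G) n∸m) ⟩
      F r * digitProduct N F q * digitProduct (suc N) G (n % b ∸ r ℕ.+ (n / b ∸ q) ℕ.* b)
        ≡⟨ cong (F r * digitProduct N F q *_) (digitProduct-digits N G (n / b ∸ q) (ℕP.≤-<-trans (ℕP.m∸n≤m (n % b) r) (m%n<n n b))) ⟩
      F r * digitProduct N F q * (G (n % b ∸ r) * digitProduct N G (n / b ∸ q))
        ≡⟨ solve 4 (λ a c e f → a :* c :* (e :* f) := a :* e :* (c :* f)) refl (F r) (digitProduct N F q) (G (n % b ∸ r)) (digitProduct N G (n / b ∸ q)) ⟩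
      F r * G (n % b ∸ r) * (digitProduct N F q * digitProduct N G (n / b ∸ q)) ∎
      where
      open ℚ-Solver
      digits⪯ = split m⪯n
      n∸m : n ∸ m ≡ n % b ∸ r ℕ.+ (n / b ∸ q) ℕ.* b
      n∸m = trans (cong (_∸ m) (m≡m%n+[m/n]*n n b))
                  (∸-digitwise b (proj₁ digits⪯) (⪯⇒≤ N (proj₂ digits⪯) q<bᴺ))

  digitProduct-⋆-Σ< : ∀ N F G n → n < b ^ N → digitProduct N (F ⋆ G) n ≡ Σ< (b ^ N) (dominatedTerm N F G n)
  digitProduct-⋆-Σ< zero    F G zero    _        = refl
  digitProduct-⋆-Σ< zero    F G (suc n) (s≤s ())
  digitProduct-⋆-Σ< (suc N) F G n       n<bᴺ⁺¹ = begin
    (F ⋆ G) (n % b) * digitProduct N (F ⋆ G) (n / b)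
      ≡⟨ cong₂ _*_ (antidiag≡Σ<-iverson (λ a c → F a * G c) (m%n<n n b)) (digitProduct-⋆-Σ< N F G (n / b) (m<b^[1+N]⇒m/b<b^N N n<bᴺ⁺¹)) ⟩
    Σ< b low * Σ< (b ^ N) high
      ≡⟨ sym (Σ<-*ˡ (b ^ N) (Σ< b low) high) ⟩
    Σ< (b ^ N) (λ q → Σ< b low * high q)
      ≡⟨ Σ<-cong (b ^ N) (λ q _ → sym (Σ<-*ʳ b (high q) low)) ⟩
    Σ< (b ^ N) (λ q → Σ< b (λ r → low r * high q))
      ≡⟨ Σ<-cong (b ^ N) (λ q q< → Σ<-cong b (λ r r< → sym (dominatedTerm-digits N F G n q< r<))) ⟩
    Σ< (b ^ N) (λ q → Σ< b (λ r → dominatedTerm (suc N) F G n (r ℕ.+ q ℕ.* b)))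
      ≡⟨ sym (Σ<-divMod (b ^ N) b (dominatedTerm (suc N) F G n)) ⟩
    Σ< (b ^ N ℕ.* b) (dominatedTerm (suc N) F G n)
      ≡⟨ cong (λ k → Σ< k (dominatedTerm (suc N) F G n)) (ℕP.*-comm (b ^ N) b) ⟩
    Σ< (b ^ suc N) (dominatedTerm (suc N) F G n) ∎
    where
    low  = λ r → iverson (r ≤? n % b) (F r * G (n % b ∸ r))
    high = dominatedTerm N F G (n / b)

  Σ-dominated : ∀ N n g → Σ-list (dominated b N n) g ≡ Σ< (b ^ N) (λ m → iverson (m ⪯?[ b , N ] n) (g m))
  Σ-dominated N n g = trans (Σ-list-filter (λ m → m ⪯?[ b , N ] n) (upTo (b ^ N)) g)
                            (Σ-list-applyUpTo (λ k → k) (b ^ N) (λ m → iverson (m ⪯?[ b , N ] n) (g m)))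

  digitProduct-⋆ : ∀ N F G n → n < b ^ N →
    digitProduct N (F ⋆ G) n ≡ Σ-list (dominated b N n) (λ m → digitProduct N F m * digitProduct N G (n ∸ m))
  digitProduct-⋆ N F G n n<bᴺ = trans (digitProduct-⋆-Σ< N F G n n<bᴺ) (sym (Σ-dominated N n _))

corollary1p3 : (b : ℕ) .{{_ : NonZero b}} → 2 ≤ b → (n N : ℕ) → 1 ≤ N → n < b ^ N →
    (x y : ℚ) →
    ∏[ b from 0 ] (λ j → binom (x + y + ℚ[ j ] - ℚ[ 1 ]) j ^ℚ μ b N j n)
      ≡ Σ-list (dominated b N n) (λ m →
          ∏[ b ∸ 1 from 1 ] (λ j → binom (x + ℚ[ j ] - ℚ[ 1 ]) j ^ℚ μ b N j m)
          * ∏[ b ∸ 1 from 1 ] (λ j → binom (y + ℚ[ j ] - ℚ[ 1 ]) j ^ℚ μ b N j (n ∸ m)))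
corollary1p3 b@(suc b-1) _ n N _ n<bᴺ x y = begin
  ∏[ b from 0 ] (λ j → multichoose (x + y) j ^ℚ μ b N j n)
    ≡⟨ ∏-^μ N (multichoose (x + y)) n ⟩
  digitProduct N (multichoose (x + y)) n
    ≡⟨ digitProduct-cong N (λ d → sym (multichoose-vandermonde x y d)) n ⟩
  digitProduct N (multichoose x ⋆ multichoose y) n
    ≡⟨ digitProduct-⋆ N (multichoose x) (multichoose y) n n<bᴺ ⟩
  Σ-list (dominated b N n) (λ m → digitProduct N (multichoose x) m * digitProduct N (multichoose y) (n ∸ m))
    ≡⟨ Σ-list-cong (dominated b N n) (λ m → sym (cong₂ _*_ (∏₁-^μ x m) (∏₁-^μ y (n ∸ m)))) ⟩
  Σ-list (dominated b N n) (λ m → ∏[ b-1 from 1 ] (λ j → multichoose x j ^ℚ μ b N j m)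
                                  * ∏[ b-1 from 1 ] (λ j → multichoose y j ^ℚ μ b N j (n ∸ m))) ∎
  where
  open Digits b
  ∏₁-^μ : ∀ z m → ∏[ b-1 from 1 ] (λ j → multichoose z j ^ℚ μ b N j m) ≡ digitProduct N (multichoose z) m
  ∏₁-^μ z m = begin
    P                                                  ≡⟨ sym (*-identityˡ P) ⟩
    1ℚ * P                                             ≡⟨ cong (_* P) (sym (1^ℚ (μ b N 0 m))) ⟩
    ∏[ b from 0 ] (λ j → multichoose z j ^ℚ μ b N j m) ≡⟨ ∏-^μ N (multichoose z) m ⟩
    digitProduct N (multichoose z) m                   ∎
    where
    P = ∏[ b-1 from 1 ] (λ j → multichoose z j ^ℚ μ b N j m)
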